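{- Let $m,n\ge 1$ and let $a_1,\ldots,a_m,b_1,\ldots,b_m,c_1,\ldots,c_n,d_1,\ldots,d_n$ be nonnegative integers with $a_i\le b_i$ for $1\le i\le m$, $c_j\le d_j$ for $1\le j\le n$, $b_1\ge b_2\ge\cdots\ge b_m$ and $d_1\ge d_2\ge \cdots\ge d_n$. Suppose that $$\sum_{i=1}^k b_i\le \sum_{i=1}^n \min\{c_i,k\}\quad\text{for each } k \text{ with } 1\le k\le m,$$ and $$\sum_{i=1}^l d_i\le \sum_{i=1}^m \min\{a_i,l\}\quad\text{for each } l \text{ with } 1\le l\le n.$$ Then every pair $(P;Q)$ with $P=(p_1,\ldots,p_m)$, $Q=(q_1,\ldots,q_n)$ of integers satisfying $a_i\le p_i\le b_i$ for $1\le i\le m$, $c_j\le q_j\le d_j$ for $1\le j\le n$, and $\sum_{i=1}^m p_i=\sum_{j=1}^n q_j$ is bigraphic.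
   Context: All graphs are finite, undirected, without loops or parallel edges. A pair $(P;Q)$ of sequences $P=(p_1,\ldots,p_m)$, $Q=(q_1,\ldots,q_n)$ of nonnegative integers is called bigraphic if there is a bipartite graph $G$ with partite sets $X=\{x_1,\ldots,x_m\}$ and $Y=\{y_1,\ldots,y_n\}$ such that $d_G(x_i)=p_i$ for $1\le i\le m$ and $d_G(y_j)=q_j$ for $1\le j\le n$. The data correspond to sequences of integer intervals $L_1=([a_1,b_1],\ldots,[a_m,b_m])$ and $L_2=([c_1,d_1],\ldots,[c_n,d_n])$. -}

module Defs where

open import Data.Nat using (ℕ; zero; suc; _+_; _≤_; _⊓_)
open import Data.Fin using (Fin; zero; suc; toℕ)
open import Data.Bool using (Bool; true; false)
open import Data.Product using (Σ; _×_; ∃-syntax)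
open import Relation.Binary.PropositionalEquality using (_≡_)

sumAll : ∀ {n} → (Fin n → ℕ) → ℕ
sumAll {zero} f = 0
sumAll {suc n} f = f zero + sumAll (λ i → f (suc i))

-- sum of the first k terms: Σ_{i=1}^{k} f i  (entries with index < k)
sumFirst : ∀ {n} → ℕ → (Fin n → ℕ) → ℕ
sumFirst {zero} k f = 0
sumFirst {suc n} zero f = 0
sumFirst {suc n} (suc k) f = f zero + sumFirst k (λ i → f (suc i))

countTrue : ∀ {n} → (Fin n → Bool) → ℕ
countTrue {zero} f = 0
countTrue {suc n} f with f zero
... | true = suc (countTrue (λ i → f (suc i)))
... | false = countTrue (λ i → f (suc i))

-- A simple bipartite graph with partite sets X = Fin m, Y = Fin n:
-- adjacency relation E x y (no loops/parallel edges by construction).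
BipGraph : ℕ → ℕ → Set
BipGraph m n = Fin m → Fin n → Bool

degX : ∀ {m n} → BipGraph m n → Fin m → ℕ
degX E i = countTrue (λ j → E i j)

degY : ∀ {m n} → BipGraph m n → Fin n → ℕ
degY E j = countTrue (λ i → E i j)

Bigraphic : ∀ {m n} → (Fin m → ℕ) → (Fin n → ℕ) → Set
Bigraphic {m} {n} P Q =
  ∃[ E ] ((∀ i → degX {m} {n} E i ≡ P i) × (∀ j → degY {m} {n} E j ≡ Q j))

NonIncreasing : ∀ {n} → (Fin n → ℕ) → Set
NonIncreasing {n} f = ∀ (i j : Fin n) → toℕ i ≤ toℕ j → f j ≤ f i

{-# OPTIONS --safe #-}
module Submission where

-- The hypotheses imply the Gale–Ryser condition for (P;Q) in its unsorted form: for every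
-- set S of rows, Σ_{i∈S} pᵢ ≤ Σⱼ min(qⱼ,|S|), because Σ_{i∈S} pᵢ ≤ b₁ + ⋯ + b_{|S|} ≤
-- Σⱼ min(cⱼ,|S|) ≤ Σⱼ min(qⱼ,|S|).  Together with Σ P = Σ Q this condition suffices:
-- join the first row to p₁ columns of largest degree.  If some other column has degree
-- larger than |S|, every chosen column does too and the right-hand side for S is unchanged;
-- otherwise the condition for S ∪ {first row} pays for the p₁ removed edges.  So the
-- condition passes to the residual pair and induction on the number of rows finishes.

open import Defs
open import Data.Nat using (ℕ; zero; suc; _+_; _∸_; _≤_; _<_; _⊓_; z≤n; s≤s; _≤?_; _<?_)
open import Data.Nat.Properties
open import Algebra.Properties.CommutativeSemigroup +-commutativeSemigroup using (interchange)
open import Data.Fin using (Fin; zero; suc)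
open import Data.Bool using (Bool; true; false; if_then_else_)
open import Data.Product using (Σ; _×_; _,_)
open import Data.Sum using (_⊎_; inj₁; inj₂; [_,_])
open import Data.Empty using (⊥; ⊥-elim)
open import Function using (_∘_)
open import Data.Vec.Functional using (_∷_)
open import Relation.Nullary using (yes; no; contradiction)
open import Relation.Binary.PropositionalEquality
  using (_≡_; refl; sym; trans; cong; cong₂; subst; subst₂; module ≡-Reasoning)

indicator : Bool → ℕ
indicator true = 1
indicator false = 0

x≡true⇒x≢false : ∀ {x} → x ≡ true → x ≡ false → ⊥
x≡true⇒x≢false refl ()

sumAll-cong : ∀ {n} {f g : Fin n → ℕ} → (∀ j → f j ≡ g j) → sumAll f ≡ sumAll g
sumAll-cong {zero} f≡g = refl
sumAll-cong {suc n} f≡g = cong₂ _+_ (f≡g zero) (sumAll-cong (f≡g ∘ suc))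

sumAll-mono-≤ : ∀ {n} {f g : Fin n → ℕ} → (∀ j → f j ≤ g j) → sumAll f ≤ sumAll g
sumAll-mono-≤ {zero} f≤g = z≤n
sumAll-mono-≤ {suc n} f≤g = +-mono-≤ (f≤g zero) (sumAll-mono-≤ (f≤g ∘ suc))

sumAll-distrib-+ : ∀ {n} (f g : Fin n → ℕ) → sumAll (λ j → f j + g j) ≡ sumAll f + sumAll g
sumAll-distrib-+ {zero} f g = refl
sumAll-distrib-+ {suc n} f g =
  trans (cong (f zero + g zero +_) (sumAll-distrib-+ (f ∘ suc) (g ∘ suc)))
        (interchange (f zero) (g zero) (sumAll (f ∘ suc)) (sumAll (g ∘ suc)))

sumAll-zero : ∀ {n} → sumAll {n} (λ _ → 0) ≡ 0
sumAll-zero {zero} = refl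
sumAll-zero {suc n} = sumAll-zero {n}

sumAll≡0⇒≡0 : ∀ {n} (f : Fin n → ℕ) → sumAll f ≡ 0 → ∀ j → f j ≡ 0
sumAll≡0⇒≡0 f sum≡0 zero = m+n≡0⇒m≡0 (f zero) sum≡0
sumAll≡0⇒≡0 f sum≡0 (suc j) = sumAll≡0⇒≡0 (f ∘ suc) (m+n≡0⇒n≡0 (f zero) sum≡0) j

card : ∀ {n} → (Fin n → Bool) → ℕ
card U = sumAll (indicator ∘ U)

countTrue≡card : ∀ {n} (U : Fin n → Bool) → countTrue U ≡ card U
countTrue≡card {zero} U = refl
countTrue≡card {suc n} U with U zero
... | true = cong suc (countTrue≡card (U ∘ suc))
... | false = countTrue≡card (U ∘ suc)

countTrue-∷ : ∀ {n} (U : Fin (suc n) → Bool) → countTrue U ≡ indicator (U zero) + countTrue (U ∘ suc)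
countTrue-∷ U with U zero
... | true = refl
... | false = refl

countTrue≤n : ∀ {n} (U : Fin n → Bool) → countTrue U ≤ n
countTrue≤n {zero} U = z≤n
countTrue≤n {suc n} U with U zero
... | true = s≤s (countTrue≤n (U ∘ suc))
... | false = m≤n⇒m≤1+n (countTrue≤n (U ∘ suc))

insert : ∀ {n} → Fin n → (Fin n → Bool) → Fin n → Bool
insert zero U zero = true
insert zero U (suc j) = U (suc j)
insert (suc k) U zero = U zero
insert (suc k) U (suc j) = insert k (U ∘ suc) j

insert-true⁻ : ∀ {n} k (U : Fin n → Bool) j → insert k U j ≡ true → j ≡ k ⊎ U j ≡ true
insert-true⁻ zero U zero _ = inj₁ refl
insert-true⁻ zero U (suc j) Uj = inj₂ Uj
insert-true⁻ (suc k) U zero U0 = inj₂ U0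
insert-true⁻ (suc k) U (suc j) ins with insert-true⁻ k (U ∘ suc) j ins
... | inj₁ j≡k = inj₁ (cong suc j≡k)
... | inj₂ Uj = inj₂ Uj

insert-false⁻ : ∀ {n} k (U : Fin n → Bool) j → insert k U j ≡ false → U j ≡ false
insert-false⁻ zero U (suc j) Uj = Uj
insert-false⁻ (suc k) U zero U0 = U0
insert-false⁻ (suc k) U (suc j) ins = insert-false⁻ k (U ∘ suc) j ins

card-insert : ∀ {n} k (U : Fin n → Bool) → U k ≡ false → card (insert k U) ≡ suc (card U)
card-insert zero U Uk rewrite Uk = refl
card-insert (suc k) U Uk =
  trans (cong (indicator (U zero) +_) (card-insert k (U ∘ suc) Uk)) (+-suc (indicator (U zero)) _)

maxOutside : ∀ {n} (U : Fin n → Bool) (q : Fin n → ℕ) →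
  (∀ j → U j ≡ true) ⊎ Σ (Fin n) λ k → U k ≡ false × (∀ j → U j ≡ false → q j ≤ q k)
maxOutside {zero} U q = inj₁ λ ()
maxOutside {suc n} U q with U zero in U0 | maxOutside (U ∘ suc) (q ∘ suc)
... | true | inj₁ all = inj₁ λ { zero → U0 ; (suc j) → all j }
... | true | inj₂ (k , out , max) =
  inj₂ (suc k , out , λ { zero Uj → ⊥-elim (x≡true⇒x≢false U0 Uj) ; (suc j) Uj → max j Uj })
... | false | inj₁ all =
  inj₂ (zero , U0 , λ { zero _ → ≤-refl ; (suc j) Uj → ⊥-elim (x≡true⇒x≢false (all j) Uj) })
... | false | inj₂ (k , out , max) with q (suc k) ≤? q zero
...   | yes below = inj₂ (zero , U0 , λ { zero _ → ≤-refl ; (suc j) Uj → ≤-trans (max j Uj) below })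
...   | no above = inj₂ (suc k , out , λ { zero _ → ≰⇒≥ above ; (suc j) Uj → max j Uj })

maxOutside-above : ∀ {n} (U : Fin n → Bool) (q : Fin n → ℕ) K →
  (∀ j → U j ≡ false → q j ≤ K) ⊎
  Σ (Fin n) λ k → U k ≡ false × K < q k × (∀ j → U j ≡ false → q j ≤ q k)
maxOutside-above U q K with maxOutside U q
... | inj₁ all = inj₁ λ j Uj → ⊥-elim (x≡true⇒x≢false (all j) Uj)
... | inj₂ (k , out , max) with K <? q k
...   | yes K<qk = inj₂ (k , out , K<qk , max)
...   | no K≮qk = inj₁ λ j Uj → ≤-trans (max j Uj) (≮⇒≥ K≮qk)

record IsTopSet {n} (q : Fin n → ℕ) (T : Fin n → Bool) : Set where
  field
    positive : ∀ j → T j ≡ true → 1 ≤ q j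
    dominant : ∀ j j′ → T j ≡ true → T j′ ≡ false → q j′ ≤ q j

open IsTopSet

emptyTop : ∀ {n} (q : Fin n → ℕ) → IsTopSet q (λ _ → false)
emptyTop q = record { positive = λ _ () ; dominant = λ _ _ () }

insert-isTopSet : ∀ {n} {q : Fin n → ℕ} {U : Fin n → Bool} {k} → IsTopSet q U →
  1 ≤ q k → (∀ j → U j ≡ false → q j ≤ q k) → IsTopSet q (insert k U)
insert-isTopSet {U = U} {k} top qk≥1 max = record
  { positive = λ j ins → [ (λ { refl → qk≥1 }) , positive top j ] (insert-true⁻ k U j ins)
  ; dominant = λ j j′ ins out′ → let out = insert-false⁻ k U j′ out′ in
      [ (λ { refl → max j′ out }) , (λ Uj → dominant top j j′ Uj out) ] (insert-true⁻ k U j ins)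
  }

positives : ∀ {n} → (Fin n → ℕ) → ℕ
positives q = sumAll (λ j → q j ⊓ 1)

positives≤card : ∀ {n} (U : Fin n → Bool) (q : Fin n → ℕ) →
  (∀ j → U j ≡ false → q j ≤ 0) → positives q ≤ card U
positives≤card U q outsideZero = sumAll-mono-≤ bound
  where
  bound : ∀ j → q j ⊓ 1 ≤ indicator (U j)
  bound j with U j in Uj
  ... | true = m⊓n≤n (q j) 1
  ... | false = ≤-trans (m⊓n≤m (q j) 1) (outsideZero j Uj)

extendTop : ∀ {n} (q : Fin n → ℕ) r (U : Fin n → Bool) → IsTopSet q U → r + card U ≤ positives q →
  Σ (Fin n → Bool) λ T → IsTopSet q T × card T ≡ r + card U
extendTop q zero U top _ = U , top , refl
extendTop q (suc r) U top room with maxOutside-above U q 0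
... | inj₁ outsideZero =
  ⊥-elim (1+n≰n (≤-trans (s≤s (m≤n+m (card U) r)) (≤-trans room (positives≤card U q outsideZero))))
... | inj₂ (k , out , qk≥1 , max) =
  let (T , topT , |T|) = extendTop q r (insert k U) (insert-isTopSet top qk≥1 max)
                           (subst (_≤ positives q) (sym r+|U′|) room)
  in T , topT , trans |T| r+|U′|
  where
  r+|U′| : r + card (insert k U) ≡ suc r + card U
  r+|U′| = trans (cong (r +_) (card-insert k U out)) (+-suc r (card U))

topSet : ∀ {n} (q : Fin n → ℕ) r → r ≤ positives q → Σ (Fin n → Bool) λ T → IsTopSet q T × card T ≡ r
topSet {n} q r r≤ =
  let (T , top , |T|) = extendTop q r (λ _ → false) (emptyTop q) (subst (_≤ positives q) (sym r+0) r≤)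
  in T , top , trans |T| r+0
  where
  r+0 : r + card {n} (λ _ → false) ≡ r
  r+0 = trans (cong (r +_) (sumAll-zero {n})) (+-identityʳ r)

sumOver : ∀ {m} → (Fin m → Bool) → (Fin m → ℕ) → ℕ
sumOver s p = sumAll (λ i → if s i then p i else 0)

GaleRyserCondition : ∀ {m n} → (Fin m → ℕ) → (Fin n → ℕ) → Set
GaleRyserCondition p q = ∀ s → sumOver s p ≤ sumAll (λ j → q j ⊓ countTrue s)

residual : ∀ {n} → (Fin n → Bool) → (Fin n → ℕ) → Fin n → ℕ
residual T q j = q j ∸ indicator (T j)

∸-indicator-+-indicator : ∀ b x → (b ≡ true → 1 ≤ x) → x ∸ indicator b + indicator b ≡ x
∸-indicator-+-indicator true x positive = m∸n+n≡m (positive refl)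
∸-indicator-+-indicator false x _ = +-identityʳ x

⊓-suc≤∸-indicator-⊓-+-indicator : ∀ b x k → (b ≡ true → 1 ≤ x) → (b ≡ false → x ≤ k) →
  x ⊓ suc k ≤ (x ∸ indicator b) ⊓ k + indicator b
⊓-suc≤∸-indicator-⊓-+-indicator true zero k positive _ = contradiction (positive refl) λ ()
⊓-suc≤∸-indicator-⊓-+-indicator true (suc x) k _ _ = ≤-reflexive (+-comm 1 (x ⊓ k))
⊓-suc≤∸-indicator-⊓-+-indicator false x k _ small =
  ≤-trans (m⊓n≤m x (suc k)) (≤-reflexive (sym (trans (+-identityʳ _) (m≤n⇒m⊓n≡m (small refl)))))

⊓≤∸-indicator-⊓ : ∀ b x k → (b ≡ true → k < x) → x ⊓ k ≤ (x ∸ indicator b) ⊓ k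
⊓≤∸-indicator-⊓ true zero k large = contradiction (large refl) λ ()
⊓≤∸-indicator-⊓ true (suc x) k large =
  ≤-reflexive (trans (m≥n⇒m⊓n≡n (m≤n⇒m≤1+n k≤x)) (sym (m≥n⇒m⊓n≡n k≤x)))
  where k≤x = ≤-pred (large refl)
⊓≤∸-indicator-⊓ false x k _ = ≤-refl

sumAll-residual : ∀ {n} {q : Fin n → ℕ} {T} → IsTopSet q T → sumAll (residual T q) + card T ≡ sumAll q
sumAll-residual {q = q} {T} top =
  trans (sym (sumAll-distrib-+ (residual T q) (indicator ∘ T)))
        (sumAll-cong λ j → ∸-indicator-+-indicator (T j) (q j) (positive top j))

residual-condition : ∀ {m n} {p : Fin (suc m) → ℕ} {q : Fin n → ℕ} {T} → IsTopSet q T →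
  card T ≡ p zero → GaleRyserCondition p q → GaleRyserCondition (p ∘ suc) (residual T q)
residual-condition {p = p} {q} {T} top |T| cond s with maxOutside-above T q (countTrue s)
... | inj₁ outsideSmall = +-cancelʳ-≤ (p zero) _ _ (begin
  sumOver s (p ∘ suc) + p zero
    ≡⟨ +-comm _ (p zero) ⟩
  sumOver (true ∷ s) p
    ≤⟨ cond (true ∷ s) ⟩
  sumAll (λ j → q j ⊓ suc (countTrue s))
    ≤⟨ sumAll-mono-≤ (λ j → ⊓-suc≤∸-indicator-⊓-+-indicator (T j) (q j) _ (positive top j) (outsideSmall j)) ⟩
  sumAll (λ j → residual T q j ⊓ countTrue s + indicator (T j))
    ≡⟨ sumAll-distrib-+ (λ j → residual T q j ⊓ countTrue s) (indicator ∘ T) ⟩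
  sumAll (λ j → residual T q j ⊓ countTrue s) + card T
    ≡⟨ cong (_ +_) |T| ⟩
  sumAll (λ j → residual T q j ⊓ countTrue s) + p zero ∎)
  where open ≤-Reasoning
... | inj₂ (k , out , k<qk , _) =
  ≤-trans (cond (false ∷ s))
    (sumAll-mono-≤ λ j → ⊓≤∸-indicator-⊓ (T j) (q j) _ (λ Tj → <-≤-trans k<qk (dominant top j k Tj out)))

firstRow≤positives : ∀ {m n} {p : Fin (suc m) → ℕ} {q : Fin n → ℕ} →
  GaleRyserCondition p q → p zero ≤ positives q
firstRow≤positives {m} {p = p} {q} cond =
  subst₂ _≤_ (trans (cong (p zero +_) (sumAll-zero {m})) (+-identityʳ _))
             (cong (λ k → sumAll (λ j → q j ⊓ suc k)) (trans (countTrue≡card {m} _) (sumAll-zero {m})))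
             (cond (true ∷ λ _ → false))

residual-sum : ∀ {m n} {p : Fin (suc m) → ℕ} {q : Fin n → ℕ} {T} → IsTopSet q T →
  card T ≡ p zero → sumAll p ≡ sumAll q → sumAll (p ∘ suc) ≡ sumAll (residual T q)
residual-sum {p = p} {q} {T} top |T| sum≡ = +-cancelʳ-≡ (p zero) _ _ (begin
  sumAll (p ∘ suc) + p zero        ≡⟨ +-comm _ (p zero) ⟩
  sumAll p                         ≡⟨ sum≡ ⟩
  sumAll q                         ≡⟨ sumAll-residual top ⟨
  sumAll (residual T q) + card T   ≡⟨ cong (_ +_) |T| ⟩
  sumAll (residual T q) + p zero   ∎)
  where open ≡-Reasoning

bigraphic-∷ : ∀ {m n} {p : Fin (suc m) → ℕ} {q : Fin n → ℕ} {T} → IsTopSet q T →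
  card T ≡ p zero → Bigraphic (p ∘ suc) (residual T q) → Bigraphic p q
bigraphic-∷ {p = p} {q} {T} top |T| (E , degX-E , degY-E) = T ∷ E , degX-T∷E , degY-T∷E
  where
  open ≡-Reasoning
  degX-T∷E : ∀ i → degX (T ∷ E) i ≡ p i
  degX-T∷E zero = trans (countTrue≡card T) |T|
  degX-T∷E (suc i) = degX-E i
  degY-T∷E : ∀ j → degY (T ∷ E) j ≡ q j
  degY-T∷E j = begin
    degY (T ∷ E) j                      ≡⟨ countTrue-∷ (λ i → (T ∷ E) i j) ⟩
    indicator (T j) + degY E j          ≡⟨ cong (indicator (T j) +_) (degY-E j) ⟩
    indicator (T j) + residual T q j    ≡⟨ +-comm (indicator (T j)) _ ⟩
    residual T q j + indicator (T j)    ≡⟨ ∸-indicator-+-indicator (T j) (q j) (positive top j) ⟩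
    q j                                 ∎

galeRyser : ∀ m {n} (p : Fin m → ℕ) (q : Fin n → ℕ) →
  sumAll p ≡ sumAll q → GaleRyserCondition p q → Bigraphic p q
galeRyser zero p q sum≡ _ = (λ ()) , (λ ()) , λ j → sym (sumAll≡0⇒≡0 q (sym sum≡) j)
galeRyser (suc m) p q sum≡ cond =
  let (T , top , |T|) = topSet q (p zero) (firstRow≤positives {p = p} {q} cond)
  in bigraphic-∷ {p = p} top |T|
       (galeRyser m (p ∘ suc) (residual T q)
         (residual-sum {p = p} top |T| sum≡) (residual-condition {p = p} {q} top |T| cond))

NonIncreasing-tail : ∀ {m} {b : Fin (suc m) → ℕ} → NonIncreasing b → NonIncreasing (b ∘ suc)
NonIncreasing-tail noninc i j i≤j = noninc (suc i) (suc j) (s≤s i≤j)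

sumFirst-tail≤ : ∀ {m} {b : Fin (suc m) → ℕ} → NonIncreasing b → ∀ k → sumFirst k (b ∘ suc) ≤ sumFirst k b
sumFirst-tail≤ {zero} _ k = z≤n
sumFirst-tail≤ {suc m} _ zero = z≤n
sumFirst-tail≤ {suc m} noninc (suc k) =
  +-mono-≤ (noninc zero (suc zero) z≤n) (sumFirst-tail≤ (NonIncreasing-tail noninc) k)

sumOver≤sumFirst : ∀ {m} (s : Fin m → Bool) {P b : Fin m → ℕ} → (∀ i → P i ≤ b i) → NonIncreasing b →
  sumOver s P ≤ sumFirst (countTrue s) b
sumOver≤sumFirst {zero} s P≤b noninc = z≤n
sumOver≤sumFirst {suc m} s P≤b noninc with s zero
... | true = +-mono-≤ (P≤b zero) (sumOver≤sumFirst (s ∘ suc) (P≤b ∘ suc) (NonIncreasing-tail noninc))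
... | false = ≤-trans (sumOver≤sumFirst (s ∘ suc) (P≤b ∘ suc) (NonIncreasing-tail noninc))
                      (sumFirst-tail≤ noninc _)

sumFirst-zero : ∀ {m} (b : Fin m → ℕ) → sumFirst 0 b ≡ 0
sumFirst-zero {zero} b = refl
sumFirst-zero {suc m} b = refl

galeRyserCondition-fromBounds : ∀ {m n} {P b : Fin m → ℕ} {c Q : Fin n → ℕ} →
  (∀ i → P i ≤ b i) → (∀ j → c j ≤ Q j) → NonIncreasing b →
  (∀ k → 1 ≤ k → k ≤ m → sumFirst k b ≤ sumAll (λ j → c j ⊓ k)) →
  GaleRyserCondition P Q
galeRyserCondition-fromBounds {m} {b = b} {c} {Q} P≤b c≤Q noninc majorized s =
  ≤-trans (sumOver≤sumFirst s P≤b noninc) (bound (countTrue s) (countTrue≤n s))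
  where
  bound : ∀ k → k ≤ m → sumFirst k b ≤ sumAll (λ j → Q j ⊓ k)
  bound zero _ = subst (_≤ _) (sym (sumFirst-zero b)) z≤n
  bound (suc k) 1+k≤m =
    ≤-trans (majorized (suc k) (s≤s z≤n) 1+k≤m) (sumAll-mono-≤ λ j → ⊓-monoˡ-≤ (suc k) (c≤Q j))

theorem1p3 : (m n : ℕ) → 1 ≤ m → 1 ≤ n →
    (a b : Fin m → ℕ) (c d : Fin n → ℕ) →
    (∀ i → a i ≤ b i) → (∀ j → c j ≤ d j) →
    NonIncreasing b → NonIncreasing d →
    (∀ k → 1 ≤ k → k ≤ m → sumFirst k b ≤ sumAll (λ j → c j ⊓ k)) →
    (∀ l → 1 ≤ l → l ≤ n → sumFirst l d ≤ sumAll (λ i → a i ⊓ l)) →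
    (P : Fin m → ℕ) (Q : Fin n → ℕ) →
    (∀ i → a i ≤ P i) → (∀ i → P i ≤ b i) →
    (∀ j → c j ≤ Q j) → (∀ j → Q j ≤ d j) →
    sumAll P ≡ sumAll Q →
    Bigraphic P Q
-- The row condition and Σ P = Σ Q already suffice (Gale–Ryser).
theorem1p3 m n _ _ a b c d _ _ b-noninc _ b-majorized _ P Q _ P≤b c≤Q _ sum≡ =
  galeRyser m P Q sum≡ (galeRyserCondition-fromBounds P≤b c≤Q b-noninc b-majorized)
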